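{- Let $G=K_{r_1,\ldots,r_k}$ be a complete $k$-partite graph with $k\ge3$ and $r_j\ne3$, $r_j\ge2$ for all $j=1,\ldots,k$, and let $n=\sum_i r_i$. If, in the graph coloring game on $G$, Bob plays according to strategy $(B1)$, then, whatever Alice does, the players cannot color the whole graph using any color set with at most $\min\{2k-2,\ \sum_{i=1}^k\lceil r_i/2\rceil-1\}$ colors. Moreover, if $n$ is even, then (with Bob using $(B1)$) the players cannot color the whole graph using any color set with at most $2k-2$ colors.
   Context: Graph coloring game: given a graph $G$ and a finite set $C$ of colors, Alice and Bob alternately (Alice first) pick an uncolored vertex and give it a legal color, i.e. a color from $C$ not used on any neighbor. The game ends when all vertices are colored (Alice wins) or when no uncolored vertex has a legal color (Bob wins). $K_{r_1,\ldots,r_k}$ denotes the complete $k$-partite graph with parts (independent sets) $V_1,\ldots,V_k$, $|V_i|=r_i\ge1$, $r_1\ge\cdots\ge r_k$, every two vertices in different parts adjacent; the paper assumes that if $k\ge2$ then $r_1\ge 2$. A part is uncolored / partially colored / fully colored if none / some but not all / all of its vertices are colored. A "new color" is a color of $C$ not yet used on any vertex. Strategy $(B1)$ for Bob, where $V_i$ denotes the part in which Alice just played: (1) if $V_i$ is (still) partially colored, pick any uncolored vertex of $V_i$; (2) otherwise ($V_i$ is now fully colored), if there is a partially colored part, choose a partially colored part with the smallest number of uncolored vertices and pick any uncolored vertex of it; (3) otherwise, if there is an uncolored part, pick any vertex of a largest uncolored part. Bob assigns to the chosen vertex a new color if one is available; otherwise he reuses a color already appearing on some other vertex of the part containing the chosen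 vertex. -}

module Defs where

open import Data.Nat using (ℕ; zero; suc; _+_; _*_; _∸_; _≤_; _⊓_; ⌈_/2⌉)
open import Data.Fin as Fin using (Fin)
open import Data.Fin.Properties using () renaming (_≟_ to _≟F_)
open import Data.Maybe using (Maybe; just; nothing)
open import Data.Product using (Σ; ∃; ∃-syntax; _×_; _,_; proj₁)
open import Data.Product.Properties using (≡-dec)
open import Data.Sum using (_⊎_)
open import Data.List using (List; map; allFin)
open import Data.Nat.ListAction using (sum)
open import Relation.Nullary using (¬_; yes; no)
open import Relation.Binary.PropositionalEquality using (_≡_; _≢_)

Σ[_] : {k : ℕ} → (Fin k → ℕ) → ℕ
Σ[_] {k} f = sum (map f (allFin k))

module Game (k : ℕ) (r : Fin k → ℕ) (m : ℕ) where

  -- Vertices of K_{r_1,...,r_k}: vertex (i , x) is the x-th vertex of part V_i.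
  -- Two vertices are adjacent iff they lie in different parts.
  Vertex : Set
  Vertex = Σ (Fin k) (λ i → Fin (r i))

  part : Vertex → Fin k
  part = proj₁

  Color : Set
  Color = Fin m

  Coloring : Set
  Coloring = Vertex → Maybe Color

  empty : Coloring
  empty _ = nothing

  _[_≔_] : Coloring → Vertex → Color → Coloring
  (σ [ v ≔ c ]) w with ≡-dec _≟F_ _≟F_ w v
  ... | yes _ = just c
  ... | no  _ = σ w

  Uncolored : Coloring → Vertex → Set
  Uncolored σ v = σ v ≡ nothing

  Colored : Coloring → Vertex → Set
  Colored σ v = ∃[ c ] σ v ≡ just c

  Legal : Coloring → Vertex → Color → Set
  Legal σ v c = Uncolored σ v × (∀ w → part w ≢ part v → σ w ≢ just c)

  AllColored : Coloring → Set
  AllColored σ = ∀ v → Colored σ v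

  UncoloredPart : Coloring → Fin k → Set
  UncoloredPart σ i = ∀ x → Uncolored σ (i , x)

  PartiallyColoredPart : Coloring → Fin k → Set
  PartiallyColoredPart σ i = (∃[ x ] Colored σ (i , x)) × (∃[ y ] Uncolored σ (i , y))

  FullyColoredPart : Coloring → Fin k → Set
  FullyColoredPart σ i = ∀ x → Colored σ (i , x)

  isNothing : Maybe Color → ℕ
  isNothing nothing  = 1
  isNothing (just _) = 0

  #uncolored : Coloring → Fin k → ℕ
  #uncolored σ i = sum (map (λ x → isNothing (σ (i , x))) (allFin (r i)))

  NewColor : Coloring → Color → Set
  NewColor σ c = ∀ w → σ w ≢ just c

  -- Vertex choice of strategy (B1); i is the part where Alice just played,
  -- σ the coloring after Alice's move.
  B1Vertex : Coloring → Fin k → Vertex → Set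
  B1Vertex σ i v =
      (PartiallyColoredPart σ i × part v ≡ i)
    ⊎ (FullyColoredPart σ i × PartiallyColoredPart σ (part v)
         × (∀ j → PartiallyColoredPart σ j → #uncolored σ (part v) ≤ #uncolored σ j))
    ⊎ (FullyColoredPart σ i × (∀ j → ¬ PartiallyColoredPart σ j)
         × UncoloredPart σ (part v) × (∀ j → UncoloredPart σ j → r j ≤ r (part v)))

  B1Color : Coloring → Vertex → Color → Set
  B1Color σ v c =
      ((∃[ c' ] NewColor σ c') → NewColor σ c)
    × (¬ (∃[ c' ] NewColor σ c') →
         ∃[ w ] (w ≢ v × part w ≡ part v × σ w ≡ just c))

  B1 : Coloring → Fin k → Vertex → Color → Set
  B1 σ i v c = Uncolored σ v × B1Vertex σ i v × B1Color σ v c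

  -- Positions reachable in a play where Alice moves arbitrarily (legally) and
  -- Bob follows (B1) (with any of the choices (B1) permits).
  -- BobToMove σ i : σ reached, Bob to move, Alice just played in part V_i.
  data AliceToMove : Coloring → Set
  data BobToMove : Coloring → Fin k → Set

  data AliceToMove where
    start : AliceToMove empty
    bobMove : ∀ {σ i v c} → BobToMove σ i → Legal σ v c → B1 σ i v c →
              AliceToMove (σ [ v ≔ c ])

  data BobToMove where
    aliceMove : ∀ {σ v c} → AliceToMove σ → Legal σ v c →
                BobToMove (σ [ v ≔ c ]) (part v)

  Reachable : Coloring → Set
  Reachable σ = AliceToMove σ ⊎ (∃[ i ] BobToMove σ i)

  B1PreventsFullColoring : Set
  B1PreventsFullColoring = ∀ σ → Reachable σ → ¬ AllColored σ

{-# OPTIONS --safe #-}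
module Submission where

-- Bob answers every move of Alice in the same part while it is partially coloured, and always
-- with a new colour while one exists.  Let ν(j) count the vertices of V_j that received a colour
-- new at the time; parts are pairwise adjacent, so these colours are distinct and Σ ν ≤ m.
-- An invariant on (c, ν) for each part (c coloured vertices) shows that as soon as every part is
-- touched, ν ≥ 1 everywhere and ν ≥ 2 except on at most two parts, the second of which (opened
-- by Bob) is compensated by a part with ν ≥ 3; hence Σ ν ≥ 2k − 1 > m.  So at Bob's turn some part
-- is still uncoloured, and once no new colour is left, no vertex of it can ever be coloured.
-- The invariant needs r ≠ 3 and breaks only when Bob must open a part of size 2; then every part
-- is full or of size 2, n is odd, and the same count gives Σ ν ≥ Σ ⌈r_i/2⌉ > m.

open import Defs
open import Data.Empty using (⊥; ⊥-elim)
open import Data.Fin using (Fin; zero; suc; fromℕ<) renaming (_≤_ to _≤F_)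
open import Data.Fin.Properties using (any?; all?; ¬∀⟶∃¬; injective⇒≤)
  renaming (suc-injective to suc-injectiveᶠ; _≟_ to _≟ᶠ_)
open import Data.List using (tabulate)
open import Data.List.Properties using (map-tabulate)
open import Data.Maybe using (Maybe; just; nothing)
import Data.Maybe.Properties as Maybe
open import Data.Nat
open import Data.Nat.Divisibility
  using (_∣_; _∣0; ∣-refl; ∣-reflexive; ∣1⇒≡1; ∣m∣n⇒∣m+n; ∣m+n∣m⇒∣n)
open import Data.Nat.ListAction using () renaming (sum to sumᴸ)
open import Data.Nat.Properties
open import Data.Product using (∃; _×_; _,_; proj₁; proj₂)
open import Data.Product.Properties using (≡-dec)
open import Data.Sum using (_⊎_; inj₁; inj₂)
open import Data.Vec.Functional using (Vector; updateAt)
open import Data.Vec.Functional.Properties using (updateAt-updates; updateAt-minimal)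
open import Function using (_∘_; id)
open import Function.Definitions using (Injective)
open import Relation.Binary.PropositionalEquality
open import Relation.Nullary using (¬_; Dec; yes; no; contradiction; ¬?; _×-dec_)
open import Relation.Nullary.Decidable using (decidable-stable)

open import Algebra.Properties.CommutativeMonoid.Sum +-0-commutativeMonoid
  using (sum; ∑-distrib-+; sum-cong-≗)

byPart : ∀ {n ℓ} {P : Fin n → Set ℓ} i → P i → (∀ j → j ≢ i → P j) → ∀ j → P j
byPart i Pᵢ others j with j ≟ᶠ i
... | yes refl = Pᵢ
... | no  j≢i  = others j j≢i

sum-mono-≤ : ∀ {n} {f g : Vector ℕ n} → (∀ i → f i ≤ g i) → sum f ≤ sum g
sum-mono-≤ {zero}  _   = z≤n
sum-mono-≤ {suc n} f≤g = +-mono-≤ (f≤g zero) (sum-mono-≤ (f≤g ∘ suc))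

sum-const : ∀ n c → sum {n} (λ _ → c) ≡ n * c
sum-const zero    c = refl
sum-const (suc n) c = cong (c +_) (sum-const n c)

sum-zero : ∀ {n} {f : Vector ℕ n} → (∀ i → f i ≡ 0) → sum f ≡ 0
sum-zero {n} f≡0 = trans (sum-cong-≗ f≡0) (trans (sum-const n 0) (*-zeroʳ n))

≤-sum : ∀ {n} (f : Vector ℕ n) i → f i ≤ sum f
≤-sum f zero    = m≤m+n (f zero) _
≤-sum f (suc i) = ≤-trans (≤-sum (f ∘ suc) i) (m≤n+m _ (f zero))

0<sum⇒∃0< : ∀ {n} (f : Vector ℕ n) → 0 < sum f → ∃ λ i → 0 < f i
0<sum⇒∃0< {suc n} f 0<Σ with f zero in eq
... | suc _ = zero , subst (0 <_) (sym eq) z<s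
... | zero  = let i , 0<fi = 0<sum⇒∃0< (f ∘ suc) 0<Σ in suc i , 0<fi

sum-suc-at : ∀ {n} (f g : Vector ℕ n) i → g i ≡ suc (f i) → (∀ j → j ≢ i → g j ≡ f j) →
             sum g ≡ suc (sum f)
sum-suc-at f g zero    gᵢ others =
  cong₂ _+_ gᵢ (sum-cong-≗ (λ j → others (suc j) λ ()))
sum-suc-at f g (suc i) gᵢ others = trans
  (cong₂ _+_ (others zero λ ())
             (sum-suc-at (f ∘ suc) (g ∘ suc) i gᵢ λ j j≢i → others (suc j) (j≢i ∘ suc-injectiveᶠ)))
  (+-suc (f zero) _)

sum-updateAt-suc : ∀ {n} (f : Vector ℕ n) i → sum (updateAt f i suc) ≡ suc (sum f)
sum-updateAt-suc f i =
  sum-suc-at f _ i (updateAt-updates i f) (λ j j≢i → updateAt-minimal j i f j≢i)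

∣-sum : ∀ {d n} {f : Vector ℕ n} → (∀ i → d ∣ f i) → d ∣ sum f
∣-sum {d} {zero}  _     = d ∣0
∣-sum {d} {suc n} d∣f = ∣m∣n⇒∣m+n (d∣f zero) (∣-sum (d∣f ∘ suc))

∣-sum-gap : ∀ {d n} {f g : Vector ℕ n} → (∀ i → f i ≤ g i) → (∀ i → d ∣ g i ∸ f i) →
            d ∣ sum g → d ∣ sum f
∣-sum-gap {f = f} {g} f≤g d∣gap d∣Σg = ∣m+n∣m⇒∣n (subst (_ ∣_) split d∣Σg) (∣-sum d∣gap)
  where
  split : sum g ≡ sum (λ i → g i ∸ f i) + sum f
  split = trans (sum-cong-≗ λ i → sym (m∸n+n≡m (f≤g i))) (∑-distrib-+ _ f)

≤-updateAt-suc : ∀ {n} (f : Vector ℕ n) i j → f j ≤ updateAt f i suc j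
≤-updateAt-suc f i = byPart i (≤-trans (n≤1+n _) (≤-reflexive (sym (updateAt-updates i f))))
  λ j j≢i → ≤-reflexive (sym (updateAt-minimal j i f j≢i))

δ : ∀ {n} → Fin n → Vector ℕ n
δ i = updateAt (λ _ → 0) i suc

δ-same : ∀ {n} (i : Fin n) → δ i i ≡ 1
δ-same i = updateAt-updates i _

δ-other : ∀ {n} {i j : Fin n} → j ≢ i → δ i j ≡ 0
δ-other {i = i} {j} j≢i = updateAt-minimal j i _ j≢i

sum-δ : ∀ {n} (i : Fin n) → sum (δ i) ≡ 1
sum-δ {n} i = trans (sum-updateAt-suc (λ _ → 0) i) (cong suc (sum-zero {n} λ _ → refl))

Σ[]≡sum : ∀ {n} (f : Vector ℕ n) → Σ[ f ] ≡ sum f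
Σ[]≡sum f = trans (cong sumᴸ (map-tabulate id f)) (sumᴸ-tabulate f)
  where
  sumᴸ-tabulate : ∀ {n} (f : Vector ℕ n) → sumᴸ (tabulate f) ≡ sum f
  sumᴸ-tabulate {zero}  f = refl
  sumᴸ-tabulate {suc n} f = cong (f zero +_) (sumᴸ-tabulate (f ∘ suc))

twice-length≤suc-sum : ∀ {n} (ν : Vector ℕ n) (p a s : Fin n) →
  (∀ j → 2 + δ p j ≤ ν j + (δ a j + δ s j)) → 2 * n ≤ suc (sum ν)
twice-length≤suc-sum {n} ν p a s pointwise = +-cancelʳ-≤ 1 (2 * n) (suc (sum ν)) (begin
  2 * n + 1                              ≡⟨ cong₂ _+_ (*-comm 2 n) (sym (sum-δ p)) ⟩
  n * 2 + sum (δ p)                      ≡⟨ cong (_+ sum (δ p)) (sum-const n 2) ⟨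
  sum {n} (λ _ → 2) + sum (δ p)          ≡⟨ ∑-distrib-+ (λ _ → 2) (δ p) ⟨
  sum (λ j → 2 + δ p j)                  ≤⟨ sum-mono-≤ pointwise ⟩
  sum (λ j → ν j + (δ a j + δ s j))      ≡⟨ ∑-distrib-+ ν _ ⟩
  sum ν + sum (λ j → δ a j + δ s j)      ≡⟨ cong (sum ν +_) (∑-distrib-+ (δ a) (δ s)) ⟩
  sum ν + (sum (δ a) + sum (δ s))        ≡⟨ cong (sum ν +_) (cong₂ _+_ (sum-δ a) (sum-δ s)) ⟩
  sum ν + 2                              ≡⟨ +-suc (sum ν) 1 ⟩
  suc (sum ν) + 1                        ∎)
  where open ≤-Reasoning

module _ {n} (ν : Vector ℕ n) (positive : ∀ j → 1 ≤ ν j) where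

  one-exception : ∀ a → (∀ j → 2 ≤ ν j ⊎ j ≡ a) → 2 * n ≤ suc (sum ν)
  one-exception a large = twice-length≤suc-sum ν a a a (byPart a at-a elsewhere)
    where
    at-a : 2 + δ a a ≤ ν a + (δ a a + δ a a)
    at-a = subst (λ d → 2 + d ≤ ν a + (d + d)) (sym (δ-same a))
      (subst (3 ≤_) (+-comm 2 (ν a)) (s≤s (s≤s (positive a))))
    elsewhere : ∀ j → j ≢ a → 2 + δ a j ≤ ν j + (δ a j + δ a j)
    elsewhere j j≢a with large j
    ... | inj₁ 2≤ν = subst (λ d → 2 + d ≤ ν j + (d + d)) (sym (δ-other j≢a))
                       (subst (2 ≤_) (sym (+-identityʳ (ν j))) 2≤ν)
    ... | inj₂ j≡a = contradiction j≡a j≢a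

  two-exceptions : ∀ a s p → 3 ≤ ν p → (∀ j → 2 ≤ ν j ⊎ j ≡ a ⊎ j ≡ s) → 2 * n ≤ suc (sum ν)
  two-exceptions a s p 3≤ν large = twice-length≤suc-sum ν p a s (byPart p at-p elsewhere)
    where
    at-p : 2 + δ p p ≤ ν p + (δ a p + δ s p)
    at-p = subst (λ d → 2 + d ≤ ν p + (δ a p + δ s p)) (sym (δ-same p)) (≤-trans 3≤ν (m≤m+n _ _))
    elsewhere : ∀ j → j ≢ p → 2 + δ p j ≤ ν j + (δ a j + δ s j)
    elsewhere j j≢p = subst (λ d → 2 + d ≤ ν j + (δ a j + δ s j)) (sym (δ-other j≢p)) (pointwise (large j))
      where
      pointwise : 2 ≤ ν j ⊎ j ≡ a ⊎ j ≡ s → 2 ≤ ν j + (δ a j + δ s j)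
      pointwise (inj₁ 2≤ν)        = ≤-trans 2≤ν (m≤m+n _ _)
      pointwise (inj₂ (inj₁ refl)) =
        +-mono-≤ (positive j) (subst (λ d → 1 ≤ d + δ s j) (sym (δ-same j)) (s≤s z≤n))
      pointwise (inj₂ (inj₂ refl)) =
        +-mono-≤ (positive j) (subst (λ d → 1 ≤ δ a j + d) (sym (δ-same j)) (m≤n+m 1 _))

2∣n⇒2∤1+n : ∀ {n} → 2 ∣ n → ¬ 2 ∣ suc n
2∣n⇒2∤1+n {n} 2∣n 2∣1+n =
  contradiction (∣1⇒≡1 (∣m+n∣m⇒∣n (subst (2 ∣_) (+-comm 1 n) 2∣1+n) 2∣n)) λ ()

-- A part of size r with c coloured vertices, ν of which got a new colour, first coloured by the
-- opener: `Settled` is the invariant when Alice is to move, `Disturbed` the weaker one for the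
-- part in which Alice has just played.
data Opener : Set where
  alice bob : Opener

Settled : Opener → (r c ν : ℕ) → Set
Settled alice r c ν = (0 < c → suc c ≤ 2 * ν) × (0 < c → c < r → 2 ≤ c × 2 + c ≤ 2 * ν)
Settled bob   r c ν = 0 < c × 4 ≤ r × (c < r → suc c ≤ 2 * ν)

Disturbed : Opener → (r c ν : ℕ) → Set
Disturbed alice r c ν = suc c ≤ 2 * ν × (c ≡ r → 3 ≤ ν)
Disturbed bob   r c ν = 4 ≤ r

Thin : (c ν : ℕ) → Set
Thin c ν = 0 < c × ν < 2

0<2*ν⇒0<ν : ∀ {ν} → 0 < 2 * ν → 0 < ν
0<2*ν⇒0<ν {ν} = *-cancelˡ-< 2 0 ν

3≤2*ν⇒2≤ν : ∀ {ν} → 3 ≤ 2 * ν → 2 ≤ ν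
3≤2*ν⇒2≤ν {ν} = *-cancelˡ-< 2 1 ν

5≤2*ν⇒3≤ν : ∀ {ν} → 5 ≤ 2 * ν → 3 ≤ ν
5≤2*ν⇒3≤ν {ν} = *-cancelˡ-< 2 2 ν

≤2*⇒⌈/2⌉≤ : ∀ {r ν} → r ≤ 2 * ν → ⌈ r /2⌉ ≤ ν
≤2*⇒⌈/2⌉≤ {ν = ν} r≤2ν = subst (_ ≤_) ⌈2*ν/2⌉≡ν (⌈n/2⌉-mono r≤2ν)
  where
  ⌈2*ν/2⌉≡ν : ⌈ 2 * ν /2⌉ ≡ ν
  ⌈2*ν/2⌉≡ν = trans (cong (λ n → ⌈ ν + n /2⌉) (+-identityʳ ν)) (sym (n≡⌈n+n/2⌉ ν))

2≤∧≢2∧≢3⇒4≤ : ∀ {r} → 2 ≤ r → r ≢ 2 → r ≢ 3 → 4 ≤ r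
2≤∧≢2∧≢3⇒4≤ 2≤r r≢2 r≢3 = ≤∧≢⇒< (≤∧≢⇒< 2≤r (r≢2 ∘ sym)) (r≢3 ∘ sym)

≤2*⇒2+≤2*suc : ∀ {a ν} → a ≤ 2 * ν → 2 + a ≤ 2 * suc ν
≤2*⇒2+≤2*suc {a} {ν} a≤2ν = subst (2 + a ≤_) (sym (*-suc 2 ν)) (+-monoʳ-≤ 2 a≤2ν)

settled-untouched : ∀ {o r ν} → Settled o r 0 ν → o ≡ alice
settled-untouched {alice} _ = refl
settled-untouched {bob} (() , _)

settled-room : ∀ {o r c ν} → 0 < c → c < r → Settled o r c ν → suc c ≤ 2 * ν
settled-room {alice} 0<c _   (room , _)     = room 0<c
settled-room {bob}   _   c<r (_ , _ , room) = room c<r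

partial-settled⇒disturbed : ∀ {o r c ν} → 0 < c → c < r → Settled o r c ν → Disturbed o r c ν
partial-settled⇒disturbed {alice} 0<c c<r (room , _) = room 0<c , λ { refl → contradiction c<r (<-irrefl refl) }
partial-settled⇒disturbed {bob}   _   _   (_ , 4≤r , _) = 4≤r

settled⇒disturbed : ∀ {o r c ν} → r ≢ 3 → 0 < c → c < r → Settled o r c ν → Disturbed o r (suc c) ν
settled⇒disturbed {alice} {r} {c} {ν} r≢3 0<c c<r (_ , partial) = room , completed
  where
  room : 2 + c ≤ 2 * ν
  room = proj₂ (partial 0<c c<r)
  completed : suc c ≡ r → 3 ≤ ν
  completed refl = 5≤2*ν⇒3≤ν (≤-trans (+-monoʳ-≤ 2 3≤c) room)
    where
    3≤c : 3 ≤ c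
    3≤c = ≤∧≢⇒< (proj₁ (partial 0<c c<r)) (λ { refl → r≢3 refl })
settled⇒disturbed {bob} _ _ _ (_ , 4≤r , _) = 4≤r

disturbed⇒settled : ∀ {o r c ν} → 0 < c → c ≤ 2 * ν → Disturbed o r c ν → Settled o r (suc c) (suc ν)
disturbed⇒settled {alice} 0<c c≤2ν (room , _) =
  (λ _ → ≤2*⇒2+≤2*suc c≤2ν) , λ _ _ → s≤s 0<c , ≤2*⇒2+≤2*suc room
disturbed⇒settled {bob}   _   c≤2ν 4≤r       = z<s , 4≤r , λ _ → ≤2*⇒2+≤2*suc c≤2ν

disturbed-full⇒settled : ∀ {o r ν} → 0 < r → r ≤ 2 * ν → Disturbed o r r ν → Settled o r r ν
disturbed-full⇒settled {alice} _   _ (room , _) = (λ _ → room) , λ _ r<r → contradiction r<r (<-irrefl refl)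
disturbed-full⇒settled {bob}   0<r _ 4≤r        = 0<r , 4≤r , λ r<r → contradiction r<r (<-irrefl refl)

settled-full⇒2≤ν : ∀ {o r ν} → 2 ≤ r → r ≤ 2 * ν → Settled o r r ν → 2 ≤ ν
settled-full⇒2≤ν {alice} 2≤r _    (room , _)      = 3≤2*ν⇒2≤ν (≤-trans (s≤s 2≤r) (room (≤-trans z<s 2≤r)))
settled-full⇒2≤ν {bob}   _   r≤2ν (_ , 4≤r , _) = 3≤2*ν⇒2≤ν (≤-trans (≤-trans (n≤1+n 3) 4≤r) r≤2ν)

disturbed-full⇒2≤ν : ∀ {o r ν} → r ≤ 2 * ν → Disturbed o r r ν → 2 ≤ ν
disturbed-full⇒2≤ν {alice} _    (_ , completed) = ≤-trans (n≤1+n 2) (completed refl)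
disturbed-full⇒2≤ν {bob}   r≤2ν 4≤r             = 3≤2*ν⇒2≤ν (≤-trans (≤-trans (n≤1+n 3) 4≤r) r≤2ν)

thin-settled⇒bob : ∀ {o r c ν} → 2 ≤ r → Thin c ν → Settled o r c ν → o ≡ bob
thin-settled⇒bob {alice} {r} {c} 2≤r (0<c , ν<2) (room , partial) with c <? r
... | yes c<r = let 2≤c , room₂ = partial 0<c c<r in
  contradiction (3≤2*ν⇒2≤ν (≤-trans (n≤1+n 3) (≤-trans (+-monoʳ-≤ 2 2≤c) room₂))) (<⇒≱ ν<2)
... | no  c≮r =
  contradiction (3≤2*ν⇒2≤ν (≤-trans (s≤s (≤-trans 2≤r (≮⇒≥ c≮r))) (room 0<c))) (<⇒≱ ν<2)
thin-settled⇒bob {bob} _ _ _ = refl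

opened-by-alice : ∀ {r ν} → 2 ≤ r → Disturbed alice r 1 (suc ν)
opened-by-alice {ν = ν} 2≤r = ≤2*⇒2+≤2*suc {0} {ν} z≤n , λ { refl → contradiction 2≤r λ { (s≤s ()) } }

opened-by-bob : ∀ {r ν} → 4 ≤ r → Settled bob r 1 (suc ν)
opened-by-bob {ν = ν} 4≤r = z<s , 4≤r , λ _ → ≤2*⇒2+≤2*suc {0} {ν} z≤n

filled : ∀ {A : Set} → Maybe A → ℕ
filled (just _) = 1
filled nothing  = 0

module Positions (k : ℕ) (r : Fin k → ℕ) (m : ℕ) where
  open Game k r m public

  #colored : Coloring → Fin k → ℕ
  #colored σ j = sum λ x → filled (σ (j , x))

  Σcolored : Coloring → ℕ
  Σcolored σ = sum (#colored σ)

  module _ (σ : Coloring) (j : Fin k) where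

    #uncolored≡sum : #uncolored σ j ≡ sum λ x → isNothing (σ (j , x))
    #uncolored≡sum = Σ[]≡sum λ x → isNothing (σ (j , x))

    #colored+#uncolored : #colored σ j + #uncolored σ j ≡ r j
    #colored+#uncolored = begin
      #colored σ j + #uncolored σ j                ≡⟨ cong (#colored σ j +_) #uncolored≡sum ⟩
      #colored σ j + sum (λ x → isNothing (σ (j , x)))
        ≡⟨ ∑-distrib-+ (λ x → filled (σ (j , x))) (λ x → isNothing (σ (j , x))) ⟨
      sum (λ x → filled (σ (j , x)) + isNothing (σ (j , x))) ≡⟨ sum-cong-≗ (λ x → one (σ (j , x))) ⟩
      sum {r j} (λ _ → 1)                          ≡⟨ sum-const (r j) 1 ⟩
      r j * 1                                      ≡⟨ *-identityʳ (r j) ⟩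
      r j                                          ∎
      where
      open ≡-Reasoning
      one : ∀ a → filled a + isNothing a ≡ 1
      one (just _) = refl
      one nothing  = refl

    colored⇒0<#colored : ∀ {x} → Colored σ (j , x) → 0 < #colored σ j
    colored⇒0<#colored {x} (_ , eq) = ≤-trans (≤-reflexive (sym (cong filled eq))) (≤-sum _ x)

    uncolored⇒#colored< : ∀ {x} → Uncolored σ (j , x) → #colored σ j < r j
    uncolored⇒#colored< {x} eq = begin-strict
      #colored σ j                  <⟨ m<m+n _ 0<#uncolored ⟩
      #colored σ j + #uncolored σ j ≡⟨ #colored+#uncolored ⟩
      r j                           ∎
      where
      open ≤-Reasoning
      0<#uncolored : 0 < #uncolored σ j
      0<#uncolored = ≤-trans (≤-reflexive (sym (cong isNothing eq)))
        (≤-trans (≤-sum _ x) (≤-reflexive (sym #uncolored≡sum)))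

    #colored≤r : #colored σ j ≤ r j
    #colored≤r = subst (#colored σ j ≤_) #colored+#uncolored (m≤m+n _ _)

    #colored≡0⇒uncoloredPart : #colored σ j ≡ 0 → UncoloredPart σ j
    #colored≡0⇒uncoloredPart #colored≡0 x with σ (j , x) in eq
    ... | nothing = refl
    ... | just _  = contradiction #colored≡0 (>⇒≢ (colored⇒0<#colored (_ , eq)))

    uncoloredPart⇒#colored≡0 : UncoloredPart σ j → #colored σ j ≡ 0
    uncoloredPart⇒#colored≡0 uncolored = sum-zero (λ x → cong filled (uncolored x))

    #uncolored≡0⇒#colored≡r : #uncolored σ j ≡ 0 → #colored σ j ≡ r j
    #uncolored≡0⇒#colored≡r #uncolored≡0 = begin
      #colored σ j                  ≡⟨ +-identityʳ _ ⟨
      #colored σ j + 0              ≡⟨ cong (#colored σ j +_) #uncolored≡0 ⟨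
      #colored σ j + #uncolored σ j ≡⟨ #colored+#uncolored ⟩
      r j                           ∎
      where open ≡-Reasoning

    fullyColored⇒#colored≡r : FullyColoredPart σ j → #colored σ j ≡ r j
    fullyColored⇒#colored≡r full = #uncolored≡0⇒#colored≡r
      (trans #uncolored≡sum (sum-zero λ x → cong isNothing (proj₂ (full x))))

    0<#colored⇒colored : 0 < #colored σ j → ∃ λ x → Colored σ (j , x)
    0<#colored⇒colored 0<#colored with 0<sum⇒∃0< _ 0<#colored
    ... | x , 0<filled with σ (j , x) in eq
    ...   | just c = x , c , eq

    #colored<⇒uncolored : #colored σ j < r j → ∃ λ x → Uncolored σ (j , x)
    #colored<⇒uncolored #colored<r with 0<sum⇒∃0< _ (subst (0 <_) #uncolored≡sum 0<#uncolored)
      where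
      0<#uncolored : 0 < #uncolored σ j
      0<#uncolored = n≢0⇒n>0 λ #uncolored≡0 → <⇒≢ #colored<r (#uncolored≡0⇒#colored≡r #uncolored≡0)
    ... | x , 0<isNothing with σ (j , x) in eq
    ...   | nothing = x , eq

    partial⇒bounds : PartiallyColoredPart σ j → 0 < #colored σ j × #colored σ j < r j
    partial⇒bounds ((_ , colored) , (_ , uncolored)) =
      colored⇒0<#colored colored , uncolored⇒#colored< uncolored

    bounds⇒partial : 0 < #colored σ j → #colored σ j < r j → PartiallyColoredPart σ j
    bounds⇒partial 0< <r = 0<#colored⇒colored 0< , #colored<⇒uncolored <r

    untouched-or-full : ¬ PartiallyColoredPart σ j → #colored σ j ≡ 0 ⊎ #colored σ j ≡ r j
    untouched-or-full unpartial with #colored σ j ≟ 0 | #colored σ j <? r j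
    ... | yes untouched | _         = inj₁ untouched
    ... | no  touched   | yes <r    = contradiction (bounds⇒partial (n≢0⇒n>0 touched) <r) unpartial
    ... | no  _         | no  ≮r    = inj₂ (≤-antisym #colored≤r (≮⇒≥ ≮r))

  -- ν j counts the vertices of part j coloured with a then-new colour; `used` lists these colours.
  record Ledger (σ : Coloring) : Set where
    field
      ν              : Vector ℕ k
      #used          : ℕ
      used           : Fin #used → Color
      used-injective : Injective _≡_ _≡_ used
      used-occurs    : ∀ a → ∃ λ w → σ w ≡ just (used a)
      sum-ν≤#used    : sum ν ≤ #used
      colored≤2ν     : ∀ j → #colored σ j ≤ 2 * ν j

    sum-ν≤m : sum ν ≤ m
    sum-ν≤m = ≤-trans sum-ν≤#used (injective⇒≤ used-injective)

  ≔-same : ∀ σ v c → (σ [ v ≔ c ]) v ≡ just c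
  ≔-same σ v c with ≡-dec _≟ᶠ_ _≟ᶠ_ v v
  ... | yes _   = refl
  ... | no  v≢v = contradiction refl v≢v

  ≔-other : ∀ σ v c w → w ≢ v → (σ [ v ≔ c ]) w ≡ σ w
  ≔-other σ v c w w≢v with ≡-dec _≟ᶠ_ _≟ᶠ_ w v
  ... | yes w≡v = contradiction w≡v w≢v
  ... | no  _   = refl

  module Move {σ : Coloring} {i : Fin k} {x : Fin (r i)} (c : Color) (vacant : Uncolored σ (i , x)) where

    σ′ : Coloring
    σ′ = σ [ (i , x) ≔ c ]

    colors-target : σ′ (i , x) ≡ just c
    colors-target = ≔-same σ (i , x) c

    keeps-others : ∀ w → w ≢ (i , x) → σ′ w ≡ σ w
    keeps-others w = ≔-other σ (i , x) c w

    keeps-colors : ∀ {w d} → σ w ≡ just d → σ′ w ≡ just d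
    keeps-colors {w} σw≡d =
      trans (keeps-others w λ { refl → contradiction (trans (sym vacant) σw≡d) λ () }) σw≡d

    #colored-here : #colored σ′ i ≡ suc (#colored σ i)
    #colored-here = sum-suc-at (λ y → filled (σ (i , y))) (λ y → filled (σ′ (i , y))) x
      (trans (cong filled colors-target) (cong (suc ∘ filled) (sym vacant)))
      (λ y y≢x → cong filled (keeps-others (i , y) λ { refl → y≢x refl }))

    #colored-elsewhere : ∀ j → j ≢ i → #colored σ′ j ≡ #colored σ j
    #colored-elsewhere j j≢i = sum-cong-≗ λ y → cong filled (keeps-others (j , y) (j≢i ∘ cong proj₁))

    unchanged : (P : ℕ → ℕ → Set) {j : Fin k} {n n′ : ℕ} → j ≢ i → n′ ≡ n →
                P (#colored σ j) n → P (#colored σ′ j) n′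
    unchanged P {j} j≢i n′≡n = subst₂ P (sym (#colored-elsewhere j j≢i)) (sym n′≡n)

    unchanged⁻¹ : (P : ℕ → ℕ → Set) {j : Fin k} {n n′ : ℕ} → j ≢ i → n′ ≡ n →
                  P (#colored σ′ j) n′ → P (#colored σ j) n
    unchanged⁻¹ P {j} j≢i n′≡n = subst₂ P (#colored-elsewhere j j≢i) n′≡n

    at-target : (P : ℕ → ℕ → Set) {ν : Vector ℕ k} →
                P (suc (#colored σ i)) (suc (ν i)) → P (#colored σ′ i) (updateAt ν i suc i)
    at-target P {ν} = subst₂ P (sym #colored-here) (sym (updateAt-updates i ν))

    Σcolored-suc : Σcolored σ′ ≡ suc (Σcolored σ)
    Σcolored-suc = sum-suc-at (#colored σ) (#colored σ′) i #colored-here #colored-elsewhere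

    #colored≤suc : ∀ j → #colored σ′ j ≤ suc (#colored σ j)
    #colored≤suc = byPart i (≤-reflexive #colored-here)
      λ j j≢i → ≤-trans (≤-reflexive (#colored-elsewhere j j≢i)) (n≤1+n _)

    ledger-new : NewColor σ c → Ledger σ → Ledger σ′
    ledger-new new L = record
      { ν              = updateAt ν i suc
      ; #used          = suc #used
      ; used           = used′
      ; used-injective = used′-injective
      ; used-occurs    = used′-occurs
      ; sum-ν≤#used    = ≤-trans (≤-reflexive (sum-updateAt-suc ν i)) (s≤s sum-ν≤#used)
      ; colored≤2ν     = byPart i
          (at-target (λ c n → c ≤ 2 * n) (≤-trans (n≤1+n _) (≤2*⇒2+≤2*suc (colored≤2ν i))))
          λ j j≢i → unchanged (λ c n → c ≤ 2 * n) j≢i (updateAt-minimal j i ν j≢i) (colored≤2ν j)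
      }
      where
      open Ledger L
      used′ : Fin (suc #used) → Color
      used′ zero    = c
      used′ (suc a) = used a
      used′-injective : Injective _≡_ _≡_ used′
      used′-injective {zero}  {zero}  _  = refl
      used′-injective {zero}  {suc b} eq =
        let w , σw≡ = used-occurs b in contradiction (trans σw≡ (cong just (sym eq))) (new w)
      used′-injective {suc a} {zero}  eq =
        let w , σw≡ = used-occurs a in contradiction (trans σw≡ (cong just eq)) (new w)
      used′-injective {suc a} {suc b} eq = cong suc (used-injective eq)
      used′-occurs : ∀ a → ∃ λ w → σ′ w ≡ just (used′ a)
      used′-occurs zero    = (i , x) , colors-target
      used′-occurs (suc a) = let w , σw≡ = used-occurs a in w , keeps-colors σw≡

    ledger-old : (L : Ledger σ) → suc (#colored σ i) ≤ 2 * Ledger.ν L i → Ledger σ′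
    ledger-old L room = record
      { Ledger L
      ; used-occurs = λ a → let w , σw≡ = Ledger.used-occurs L a in w , keeps-colors σw≡
      ; colored≤2ν  = byPart i (subst (_≤ 2 * Ledger.ν L i) (sym #colored-here) room)
          λ j j≢i → subst (_≤ 2 * Ledger.ν L j) (sym (#colored-elsewhere j j≢i)) (Ledger.colored≤2ν L j)
      }

  used? : (σ : Coloring) (c : Color) → Dec (∃ λ w → σ w ≡ just c)
  used? σ c with any? (λ j → any? λ y → Maybe.≡-dec _≟ᶠ_ (σ (j , y)) (just c))
  ... | yes (j , y , σjy≡c) = yes ((j , y) , σjy≡c)
  ... | no  unused          = no λ { ((j , y) , σjy≡c) → unused (j , y , σjy≡c) }

  new-or-exhausted : ∀ σ → (∃ λ c → NewColor σ c) ⊎ (∀ c → ∃ λ w → σ w ≡ just c)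
  new-or-exhausted σ with all? (used? σ)
  ... | yes exhausted = inj₂ exhausted
  ... | no  ¬exhausted =
    let c , unused = ¬∀⟶∃¬ m _ (used? σ) ¬exhausted in inj₁ (c , λ w σw≡c → unused (w , σw≡c))

  opening-uses-new-color : ∀ {σ i x c} → UncoloredPart σ i → Legal σ (i , x) c → NewColor σ c
  opening-uses-new-color {i = i} uncolored (_ , proper) (j , y) σjy≡c with j ≟ᶠ i
  ... | yes refl = contradiction (trans (sym (uncolored y)) σjy≡c) λ ()
  ... | no  j≢i  = proper (j , y) j≢i σjy≡c

  Stuck : Coloring → Set
  Stuck σ = (∃ λ j → UncoloredPart σ j) × (∀ c → ∃ λ w → σ w ≡ just c)

  stuck-stays : ∀ {σ i x c} → Stuck σ → (legal : Legal σ (i , x) c) →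
                Stuck (Move.σ′ {σ} {i} {x} c (proj₁ legal))
  stuck-stays {σ} {i} {x} {c} ((j , uncolored) , exhausted) legal@(vacant , _) =
    (j , uncolored′) , λ d → let w , σw≡d = exhausted d in w , keeps-colors σw≡d
    where
    open Move {σ} {i} {x} c vacant
    i≢j : i ≢ j
    i≢j refl = let w , σw≡c = exhausted c in opening-uses-new-color uncolored legal w σw≡c
    uncolored′ : UncoloredPart σ′ j
    uncolored′ y = trans (keeps-others (j , y) λ eq → i≢j (sym (cong proj₁ eq))) (uncolored y)

module Strategy (k : ℕ) (r : Fin k → ℕ) (m : ℕ)
  (r≥2 : ∀ j → 2 ≤ r j) (r≢3 : ∀ j → r j ≢ 3) (m+2≤2k : m + 2 ≤ 2 * k)
  (odd⇒m<Σ⌈r/2⌉ : ¬ 2 ∣ Σ[ r ] → m < Σ[ (λ j → ⌈ r j /2⌉) ])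
  where

  open Positions k r m

  record AliceInvariant (σ : Coloring) (ν : Vector ℕ k) (o : Fin k → Opener) : Set where
    field
      settled     : ∀ j → Settled (o j) (r j) (#colored σ j) (ν j)
      thin-unique : ∀ a b → Thin (#colored σ a) (ν a) → Thin (#colored σ b) (ν b) → a ≡ b
      bob-witness : ∀ j → o j ≡ bob → ∃ λ p → 3 ≤ ν p
      even        : 2 ∣ Σcolored σ

  record BobInvariant (σ : Coloring) (ν : Vector ℕ k) (o : Fin k → Opener) (i₀ : Fin k) : Set where
    field
      settled     : ∀ j → j ≢ i₀ → Settled (o j) (r j) (#colored σ j) (ν j)
      disturbed   : Disturbed (o i₀) (r i₀) (#colored σ i₀) (ν i₀)
      thin-unique : ∀ a b → a ≢ i₀ → b ≢ i₀ →
                    Thin (#colored σ a) (ν a) → Thin (#colored σ b) (ν b) → a ≡ b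
      bob-witness : ∀ j → o j ≡ bob → ∃ λ p → 3 ≤ ν p
      odd         : 2 ∣ suc (Σcolored σ)

  -- Entered when Bob has to open a part of size 2, which forces Σ r to be odd.
  record Endgame (σ : Coloring) : Set where
    field
      odd-total    : ¬ 2 ∣ Σ[ r ]
      full-or-pair : ∀ j → #colored σ j ≡ r j ⊎ r j ≡ 2

  AlicePhase : Coloring → Vector ℕ k → Set
  AlicePhase σ ν = (∃ λ o → AliceInvariant σ ν o) ⊎ Endgame σ

  BobPhase : Coloring → Vector ℕ k → Fin k → Set
  BobPhase σ ν i₀ = (∃ λ o → BobInvariant σ ν o i₀) ⊎ Endgame σ

  record AliceState (σ : Coloring) : Set where
    field
      ledger  : Ledger σ
      vacancy : ∃ λ v → Uncolored σ v
      phase   : AlicePhase σ (Ledger.ν ledger)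

  record BobState (σ : Coloring) (i₀ : Fin k) : Set where
    field
      ledger    : Ledger σ
      untouched : ∃ λ j → UncoloredPart σ j
      phase     : BobPhase σ (Ledger.ν ledger) i₀

  module _ {σ : Coloring} (L : Ledger σ) (touched : ∀ j → 0 < #colored σ j) where
    open Ledger L

    1≤ν : ∀ j → 1 ≤ ν j
    1≤ν j = 0<2*ν⇒0<ν (≤-trans (touched j) (colored≤2ν j))

    too-many-colors : 2 * k ≤ suc (sum ν) → ⊥
    too-many-colors 2k≤ = contradiction (≤-trans m+2≤2k (≤-trans 2k≤ (s≤s sum-ν≤m)))
      (<⇒≱ (subst (suc m <_) (+-comm 2 m) ≤-refl))

    all-touched-bob : ∀ {o i₀} → BobInvariant σ ν o i₀ → ⊥
    all-touched-bob {o} {i₀} inv with any? (λ s → ¬? (s ≟ᶠ i₀) ×-dec (ν s <? 2))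
    ... | yes (s , s≢i₀ , νs<2) = too-many-colors (two-exceptions ν 1≤ν i₀ s p 3≤νp large)
      where
      open BobInvariant inv
      witness = bob-witness s (thin-settled⇒bob (r≥2 s) (touched s , νs<2) (settled s s≢i₀))
      p = proj₁ witness
      3≤νp = proj₂ witness
      large : ∀ j → 2 ≤ ν j ⊎ j ≡ i₀ ⊎ j ≡ s
      large j with 2 ≤? ν j | j ≟ᶠ i₀
      ... | yes 2≤ν | _        = inj₁ 2≤ν
      ... | no  _   | yes j≡i₀ = inj₂ (inj₁ j≡i₀)
      ... | no  2≰ν | no  j≢i₀ =
        inj₂ (inj₂ (thin-unique j s j≢i₀ s≢i₀ (touched j , ≰⇒> 2≰ν) (touched s , νs<2)))
    ... | no  ¬thin = too-many-colors (one-exception ν 1≤ν i₀ large)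
      where
      large : ∀ j → 2 ≤ ν j ⊎ j ≡ i₀
      large j with 2 ≤? ν j | j ≟ᶠ i₀
      ... | yes 2≤ν | _        = inj₁ 2≤ν
      ... | no  _   | yes j≡i₀ = inj₂ j≡i₀
      ... | no  2≰ν | no  j≢i₀ = contradiction (j , j≢i₀ , ≰⇒> 2≰ν) ¬thin

    all-touched-endgame : Endgame σ → ⊥
    all-touched-endgame eg = contradiction (≤-trans (odd⇒m<Σ⌈r/2⌉ odd-total) Σ⌈r/2⌉≤m) (<-irrefl refl)
      where
      open Endgame eg
      ⌈r/2⌉≤ν : ∀ j → ⌈ r j /2⌉ ≤ ν j
      ⌈r/2⌉≤ν j with full-or-pair j
      ... | inj₁ full = ≤2*⇒⌈/2⌉≤ (subst (_≤ 2 * ν j) full (colored≤2ν j))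
      ... | inj₂ pair = subst (λ a → ⌈ a /2⌉ ≤ ν j) (sym pair) (1≤ν j)
      Σ⌈r/2⌉≤m : Σ[ (λ j → ⌈ r j /2⌉) ] ≤ m
      Σ⌈r/2⌉≤m = ≤-trans (≤-reflexive (Σ[]≡sum λ j → ⌈ r j /2⌉))
                         (≤-trans (sum-mono-≤ ⌈r/2⌉≤ν) sum-ν≤m)

    all-touched : ∀ {i₀} → BobPhase σ ν i₀ → ⊥
    all-touched (inj₁ (_ , inv)) = all-touched-bob inv
    all-touched (inj₂ eg)        = all-touched-endgame eg

  bob-state : ∀ {σ i₀} (L : Ledger σ) → BobPhase σ (Ledger.ν L) i₀ → BobState σ i₀
  bob-state {σ} L phase with any? (λ j → #colored σ j ≟ 0)
  ... | yes (j , untouched) =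
    record { ledger = L ; untouched = j , #colored≡0⇒uncoloredPart σ j untouched ; phase = phase }
  ... | no  ¬untouched = ⊥-elim (all-touched L (λ j → n≢0⇒n>0 λ untouched → ¬untouched (j , untouched)) phase)

  module Step {σ : Coloring} {i : Fin k} {x : Fin (r i)} {c : Color} (vacant : Uncolored σ (i , x)) where
    open Move {σ} {i} {x} c vacant public

    endgame-pair : Endgame σ → r i ≡ 2
    endgame-pair eg with Endgame.full-or-pair eg i
    ... | inj₁ full = contradiction full (<⇒≢ (uncolored⇒#colored< σ i vacant))
    ... | inj₂ pair = pair

    endgame-step : Endgame σ → Endgame σ′
    endgame-step eg = record
      { odd-total    = odd-total
      ; full-or-pair = byPart i (inj₂ (endgame-pair eg))
          λ j j≢i → subst (λ c → c ≡ r j ⊎ r j ≡ 2) (sym (#colored-elsewhere j j≢i)) (full-or-pair j)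
      }
      where open Endgame eg

    endgame-room : Endgame σ → (L : Ledger σ) → 0 < #colored σ i → suc (#colored σ i) ≤ 2 * Ledger.ν L i
    endgame-room eg L 0<c = ≤-trans (s≤s c≤1)
      (*-monoʳ-≤ 2 {1} {Ledger.ν L i} (0<2*ν⇒0<ν (≤-trans 0<c (Ledger.colored≤2ν L i))))
      where
      c≤1 : #colored σ i ≤ 1
      c≤1 = ≤-pred (subst (#colored σ i <_) (endgame-pair eg) (uncolored⇒#colored< σ i vacant))

    module AliceMoves {ν o} (inv : AliceInvariant σ ν o) where
      open AliceInvariant inv

      moved : (ν′ : Vector ℕ k) → (∀ j → j ≢ i → ν′ j ≡ ν j) → (∀ j → ν j ≤ ν′ j) →
              Disturbed (o i) (r i) (#colored σ′ i) (ν′ i) → BobInvariant σ′ ν′ o i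
      moved ν′ same ν≤ν′ disturbed = record
        { settled     = λ j j≢i → unchanged (Settled (o j) (r j)) j≢i (same j j≢i) (settled j)
        ; disturbed   = disturbed
        ; thin-unique = λ a b a≢i b≢i thin-a thin-b → thin-unique a b
            (unchanged⁻¹ Thin a≢i (same a a≢i) thin-a)
            (unchanged⁻¹ Thin b≢i (same b b≢i) thin-b)
        ; bob-witness = λ j oj≡bob → let p , 3≤νp = bob-witness j oj≡bob in p , ≤-trans 3≤νp (ν≤ν′ p)
        ; odd         = subst (λ n → 2 ∣ suc n) (sym Σcolored-suc) (∣m∣n⇒∣m+n (∣-refl {2}) even)
        }

      opening : #colored σ i ≡ 0 → BobInvariant σ′ (updateAt ν i suc) o i
      opening untouched = moved (updateAt ν i suc) (λ j j≢i → updateAt-minimal j i ν j≢i) (≤-updateAt-suc ν i)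
        (at-target (Disturbed (o i) (r i)) (subst₂ (λ o c → Disturbed o (r i) (suc c) (suc (ν i)))
          (sym by-alice) (sym untouched) (opened-by-alice (r≥2 i))))
        where
        by-alice : o i ≡ alice
        by-alice = settled-untouched (subst (λ c → Settled (o i) (r i) c (ν i)) untouched (settled i))

      continuing : 0 < #colored σ i → BobInvariant σ′ ν o i
      continuing 0<c = moved ν (λ _ _ → refl) (λ _ → ≤-refl)
        (subst (λ c → Disturbed (o i) (r i) c (ν i)) (sym #colored-here)
          (settled⇒disturbed (r≢3 i) 0<c (uncolored⇒#colored< σ i vacant) (settled i)))

    vacancy-after : (∃ λ j → UncoloredPart σ j) → ∃ λ v → Uncolored σ′ v
    vacancy-after (j , uncolored) = let y , vacant′ = #colored<⇒uncolored σ′ j c′<r in (j , y) , vacant′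
      where
      c′<r : #colored σ′ j < r j
      c′<r = ≤-trans (s≤s (≤-trans (#colored≤suc j) (s≤s (≤-reflexive untouched)))) (r≥2 j)
        where untouched = uncoloredPart⇒#colored≡0 σ j uncolored

    module BobMoves {ν : Vector ℕ k} {o : Fin k → Opener} {i₀ : Fin k}
                    (colored≤2ν : ∀ j → #colored σ j ≤ 2 * ν j) (inv : BobInvariant σ ν o i₀) where
      open BobInvariant inv

      ν⁺ : Vector ℕ k
      ν⁺ = updateAt ν i suc

      ν⁺-elsewhere : ∀ j → j ≢ i → ν⁺ j ≡ ν j
      ν⁺-elsewhere j j≢i = updateAt-minimal j i ν j≢i

      even′ : 2 ∣ Σcolored σ′
      even′ = subst (2 ∣_) (sym Σcolored-suc) odd

      witness′ : ∀ j → o j ≡ bob → ∃ λ p → 3 ≤ ν⁺ p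
      witness′ j oj≡bob = let p , 3≤νp = bob-witness j oj≡bob in p , ≤-trans 3≤νp (≤-updateAt-suc ν i p)

      full⇒2≤ν : ∀ j → #colored σ j ≡ r j → 2 ≤ ν j
      full⇒2≤ν = byPart i₀
        (λ full → disturbed-full⇒2≤ν (r≤2ν full)
          (subst (λ c → Disturbed (o i₀) (r i₀) c (ν i₀)) full disturbed))
        λ j j≢i₀ full → settled-full⇒2≤ν (r≥2 j) (r≤2ν full)
          (subst (λ c → Settled (o j) (r j) c (ν j)) full (settled j j≢i₀))
        where
        r≤2ν : ∀ {j} → #colored σ j ≡ r j → r j ≤ 2 * ν j
        r≤2ν {j} full = subst (_≤ 2 * ν j) full (colored≤2ν j)

      answered-not-thin : 0 < #colored σ i → ¬ Thin (#colored σ′ i) (ν⁺ i)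
      answered-not-thin 0<c (_ , ν⁺<2) = <⇒≱ ν⁺<2
        (≤-trans (s≤s (0<2*ν⇒0<ν (≤-trans 0<c (colored≤2ν i)))) (≤-reflexive (sym (updateAt-updates i ν))))

      thin-unique′ : (∀ j → Thin (#colored σ′ j) (ν⁺ j) → j ≢ i × j ≢ i₀) →
                     ∀ a b → Thin (#colored σ′ a) (ν⁺ a) → Thin (#colored σ′ b) (ν⁺ b) → a ≡ b
      thin-unique′ excluded a b thin-a thin-b = thin-unique a b a≢i₀ b≢i₀
        (unchanged⁻¹ Thin a≢i (ν⁺-elsewhere a a≢i) thin-a)
        (unchanged⁻¹ Thin b≢i (ν⁺-elsewhere b b≢i) thin-b)
        where
        a≢i = proj₁ (excluded a thin-a)
        a≢i₀ = proj₂ (excluded a thin-a)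
        b≢i = proj₁ (excluded b thin-b)
        b≢i₀ = proj₂ (excluded b thin-b)

      settled-after-completion : FullyColoredPart σ i₀ → ∀ j → Settled (o j) (r j) (#colored σ j) (ν j)
      settled-after-completion completed = byPart i₀
        (subst (λ c → Settled (o i₀) (r i₀) c (ν i₀)) (sym full)
          (disturbed-full⇒settled (≤-trans z<s (r≥2 i₀)) (subst (_≤ 2 * ν i₀) full (colored≤2ν i₀))
            (subst (λ c → Disturbed (o i₀) (r i₀) c (ν i₀)) full disturbed)))
        settled
        where full = fullyColored⇒#colored≡r σ i₀ completed

      answer : PartiallyColoredPart σ i → i ≡ i₀ → AliceInvariant σ′ ν⁺ o
      answer partial i≡i₀ = record
        { settled     = byPart i (at-target (Settled (o i) (r i)) (disturbed⇒settled 0<c (colored≤2ν i) disturbedᵢ))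
            λ j j≢i → unchanged (Settled (o j) (r j)) j≢i (ν⁺-elsewhere j j≢i)
                         (settled j (≢i⇒≢i₀ j≢i))
        ; thin-unique = thin-unique′ λ j thin → let j≢i = λ { refl → answered-not-thin 0<c thin } in
            j≢i , ≢i⇒≢i₀ j≢i
        ; bob-witness = witness′
        ; even        = even′
        }
        where
        0<c = proj₁ (partial⇒bounds σ i partial)
        disturbedᵢ = subst (λ j → Disturbed (o j) (r j) (#colored σ j) (ν j)) (sym i≡i₀) disturbed
        ≢i⇒≢i₀ : ∀ {j} → j ≢ i → j ≢ i₀
        ≢i⇒≢i₀ j≢i j≡i₀ = j≢i (trans j≡i₀ (sym i≡i₀))

      continue : FullyColoredPart σ i₀ → PartiallyColoredPart σ i → AliceInvariant σ′ ν⁺ o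
      continue completed partial = record
        { settled     = byPart i (at-target (Settled (o i) (r i))
              (disturbed⇒settled 0<c (colored≤2ν i) (partial-settled⇒disturbed 0<c c<r (all-settled i))))
            λ j j≢i → unchanged (Settled (o j) (r j)) j≢i (ν⁺-elsewhere j j≢i) (all-settled j)
        ; thin-unique = thin-unique′ λ j thin → (λ { refl → answered-not-thin 0<c thin })
            , λ { refl → <⇒≱ (proj₂ thin) (≤-trans (full⇒2≤ν i₀ full) (≤-updateAt-suc ν i i₀)) }
        ; bob-witness = witness′
        ; even        = even′
        }
        where
        all-settled = settled-after-completion completed
        full = fullyColored⇒#colored≡r σ i₀ completed
        0<c = proj₁ (partial⇒bounds σ i partial)
        c<r = proj₂ (partial⇒bounds σ i partial)

      module Opening (completed : FullyColoredPart σ i₀) (no-partial : ∀ j → ¬ PartiallyColoredPart σ j)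
                     (uncolored : UncoloredPart σ i) (largest : ∀ j → UncoloredPart σ j → r j ≤ r i) where

        opening-pair : r i ≡ 2 → Endgame σ′
        opening-pair pair = record
          { odd-total    = λ 2∣Σr →
              2∣n⇒2∤1+n (∣-sum-gap (#colored≤r σ) gap-even (subst (2 ∣_) (Σ[]≡sum r) 2∣Σr)) odd
          ; full-or-pair = byPart i (inj₂ pair)
              λ j j≢i → subst (λ c → c ≡ r j ⊎ r j ≡ 2) (sym (#colored-elsewhere j j≢i)) (full-or-pair j)
          }
          where
          untouched⇒pair : ∀ j → #colored σ j ≡ 0 → r j ≡ 2
          untouched⇒pair j untouched = ≤-antisym
            (≤-trans (largest j (#colored≡0⇒uncoloredPart σ j untouched)) (≤-reflexive pair)) (r≥2 j)
          full-or-pair : ∀ j → #colored σ j ≡ r j ⊎ r j ≡ 2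
          full-or-pair j with untouched-or-full σ j (no-partial j)
          ... | inj₁ untouched = inj₂ (untouched⇒pair j untouched)
          ... | inj₂ full      = inj₁ full
          gap-even : ∀ j → 2 ∣ r j ∸ #colored σ j
          gap-even j with untouched-or-full σ j (no-partial j)
          ... | inj₁ untouched = subst (λ c → 2 ∣ r j ∸ c) (sym untouched)
                                   (∣-reflexive (sym (untouched⇒pair j untouched)))
          ... | inj₂ full      = subst (λ c → 2 ∣ r j ∸ c) (sym full)
                                   (subst (2 ∣_) (sym (n∸n≡0 (r j))) (2 ∣0))

        opening-large : r i ≢ 2 → AliceInvariant σ′ ν⁺ (updateAt o i λ _ → bob)
        opening-large r≢2 = record
          { settled     = byPart i settled-i λ j j≢i →
              subst (λ o → Settled o (r j) (#colored σ′ j) (ν⁺ j)) (sym (updateAt-minimal j i o j≢i))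
                (unchanged (Settled (o j) (r j)) j≢i (ν⁺-elsewhere j j≢i) (settled-after-completion completed j))
          ; thin-unique = λ a b thin-a thin-b → trans (thin⇒i a thin-a) (sym (thin⇒i b thin-b))
          ; bob-witness = λ _ _ → witness (o i₀) refl
          ; even        = even′
          }
          where
          settled-i : Settled (updateAt o i (λ _ → bob) i) (r i) (#colored σ′ i) (ν⁺ i)
          settled-i = subst (λ o → Settled o (r i) (#colored σ′ i) (ν⁺ i)) (sym (updateAt-updates i o))
            (at-target (Settled bob (r i))
              (subst (λ c → Settled bob (r i) (suc c) (suc (ν i))) (sym (uncoloredPart⇒#colored≡0 σ i uncolored))
                (opened-by-bob (2≤∧≢2∧≢3⇒4≤ (r≥2 i) r≢2 (r≢3 i)))))
          not-thin-elsewhere : ∀ j → j ≢ i → ¬ Thin (#colored σ′ j) (ν⁺ j)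
          not-thin-elsewhere j j≢i (0<c′ , ν⁺<2) with untouched-or-full σ j (no-partial j)
          ... | inj₁ untouched = contradiction (trans (#colored-elsewhere j j≢i) untouched) (>⇒≢ 0<c′)
          ... | inj₂ full      =
            contradiction (≤-trans (full⇒2≤ν j full) (≤-updateAt-suc ν i j)) (<⇒≱ ν⁺<2)
          thin⇒i : ∀ j → Thin (#colored σ′ j) (ν⁺ j) → j ≡ i
          thin⇒i j thin = decidable-stable (j ≟ᶠ i) λ j≢i → not-thin-elsewhere j j≢i thin
          witness : ∀ oᵢ₀ → o i₀ ≡ oᵢ₀ → ∃ λ p → 3 ≤ ν⁺ p
          witness alice by-alice = i₀ , ≤-trans (proj₂ disturbedᵢ₀ (fullyColored⇒#colored≡r σ i₀ completed))
                                                (≤-updateAt-suc ν i i₀)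
            where disturbedᵢ₀ = subst (λ o → Disturbed o (r i₀) (#colored σ i₀) (ν i₀)) by-alice disturbed
          witness bob   by-bob   = witness′ i₀ by-bob

        open-part : AlicePhase σ′ ν⁺
        open-part with r i ≟ 2
        ... | yes pair = inj₂ (opening-pair pair)
        ... | no  r≢2  = inj₁ (_ , opening-large r≢2)

  alice-step : ∀ {σ i x c} → AliceState σ → (legal : Legal σ (i , x) c) → BobState (σ [ (i , x) ≔ c ]) i
  alice-step {σ} {i} {x} {c} S legal@(vacant , _) with #colored σ i ≟ 0
  ... | yes untouched = bob-state (ledger-new new ledger) (phase′ phase)
    where
    open AliceState S
    open Step {σ} {i} {x} {c} vacant
    new : NewColor σ c
    new = opening-uses-new-color (#colored≡0⇒uncoloredPart σ i untouched) legal
    phase′ : AlicePhase σ (Ledger.ν ledger) → BobPhase σ′ (updateAt (Ledger.ν ledger) i suc) i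
    phase′ (inj₁ (o , inv)) = inj₁ (o , AliceMoves.opening inv untouched)
    phase′ (inj₂ eg)        = inj₂ (endgame-step eg)
  ... | no  touched = bob-state (ledger-old ledger (room phase)) (phase′ phase)
    where
    open AliceState S
    open Step {σ} {i} {x} {c} vacant
    0<c : 0 < #colored σ i
    0<c = n≢0⇒n>0 touched
    room : AlicePhase σ (Ledger.ν ledger) → suc (#colored σ i) ≤ 2 * Ledger.ν ledger i
    room (inj₁ (o , inv)) = settled-room 0<c (uncolored⇒#colored< σ i vacant) (AliceInvariant.settled inv i)
    room (inj₂ eg)        = endgame-room eg ledger 0<c
    phase′ : AlicePhase σ (Ledger.ν ledger) → BobPhase σ′ (Ledger.ν ledger) i
    phase′ (inj₁ (o , inv)) = inj₁ (o , AliceMoves.continuing inv 0<c)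
    phase′ (inj₂ eg)        = inj₂ (endgame-step eg)

  bob-step : ∀ {σ i₀ i x c} → BobState σ i₀ → (legal : Legal σ (i , x) c) → B1 σ i₀ (i , x) c →
             Stuck (σ [ (i , x) ≔ c ]) ⊎ AliceState (σ [ (i , x) ≔ c ])
  bob-step {σ} {i₀} {i} {x} {c} S legal (_ , choice , coloring) with new-or-exhausted σ
  ... | inj₂ exhausted = inj₁ (stuck-stays (BobState.untouched S , exhausted) legal)
  ... | inj₁ some-new  = inj₂ record
    { ledger  = ledger-new (proj₁ coloring some-new) ledger
    ; vacancy = vacancy-after untouched
    ; phase   = phase′ phase
    }
    where
    open BobState S
    open Step {σ} {i} {x} {c} (proj₁ legal)
    phase′ : BobPhase σ (Ledger.ν ledger) i₀ → AlicePhase σ′ (updateAt (Ledger.ν ledger) i suc)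
    phase′ (inj₂ eg)        = inj₂ (endgame-step eg)
    phase′ (inj₁ (o , inv)) = by-choice choice
      where
      open BobMoves (Ledger.colored≤2ν ledger) inv
      by-choice : B1Vertex σ i₀ (i , x) → AlicePhase σ′ ν⁺
      by-choice (inj₁ (partial , i≡i₀)) =
        inj₁ (o , answer (subst (PartiallyColoredPart σ) (sym i≡i₀) partial) i≡i₀)
      by-choice (inj₂ (inj₁ (completed , partial , _))) = inj₁ (o , continue completed partial)
      by-choice (inj₂ (inj₂ (completed , no-partial , uncolored , largest))) =
        Opening.open-part completed no-partial uncolored largest

  initial : AliceState empty
  initial = record
    { ledger  = record
      { ν = λ _ → 0 ; #used = 0 ; used = λ () ; used-injective = λ { {()} } ; used-occurs = λ ()
      ; sum-ν≤#used = ≤-reflexive (sum-zero {k} λ _ → refl) ; colored≤2ν = λ j → ≤-reflexive (untouched j) }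
    ; vacancy = (part₀ , fromℕ< (≤-trans z<s (r≥2 part₀))) , refl
    ; phase   = inj₁ ((λ _ → alice) , record
      { settled     = λ j → subst (λ c → Settled alice (r j) c 0) (sym (untouched j)) ((λ ()) , λ ())
      ; thin-unique = λ a _ (0<c , _) → contradiction (untouched a) (>⇒≢ 0<c)
      ; bob-witness = λ _ ()
      ; even        = subst (2 ∣_) (sym (sum-zero untouched)) (2 ∣0)
      })
    }
    where
    untouched : ∀ j → #colored empty j ≡ 0
    untouched j = uncoloredPart⇒#colored≡0 empty j λ _ → refl
    part₀ : Fin k
    part₀ = fromℕ< (n≢0⇒n>0 λ { refl → contradiction (≤-trans (m≤n+m 2 m) m+2≤2k) λ () })

  alice-reachable : ∀ {σ} → AliceToMove σ → Stuck σ ⊎ AliceState σ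
  bob-reachable   : ∀ {σ i₀} → BobToMove σ i₀ → Stuck σ ⊎ BobState σ i₀

  alice-reachable start = inj₂ initial
  alice-reachable (bobMove {v = _ , _} previous legal b1) with bob-reachable previous
  ... | inj₁ stuck = inj₁ (stuck-stays stuck legal)
  ... | inj₂ S     = bob-step S legal b1

  bob-reachable (aliceMove {v = _ , _} previous legal) with alice-reachable previous
  ... | inj₁ stuck = inj₁ (stuck-stays stuck legal)
  ... | inj₂ S     = inj₂ (alice-step S legal)

  uncoloredPart⇒¬allColored : ∀ {σ j} → UncoloredPart σ j → ¬ AllColored σ
  uncoloredPart⇒¬allColored {σ} {j} uncolored all =
    let x = fromℕ< (≤-trans z<s (r≥2 j)) ; _ , colored = all (j , x) in
    contradiction (trans (sym (uncolored x)) colored) λ ()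

  prevents : B1PreventsFullColoring
  prevents σ (inj₁ alice-to-move) all with alice-reachable alice-to-move
  ... | inj₁ ((_ , uncolored) , _) = uncoloredPart⇒¬allColored uncolored all
  ... | inj₂ S = let v , vacant = AliceState.vacancy S ; _ , colored = all v in
    contradiction (trans (sym vacant) colored) λ ()
  prevents σ (inj₂ (_ , bob-to-move)) all with bob-reachable bob-to-move
  ... | inj₁ ((_ , uncolored) , _) = uncoloredPart⇒¬allColored uncolored all
  ... | inj₂ S = uncoloredPart⇒¬allColored (proj₂ (BobState.untouched S)) all

lemma6 : (k : ℕ) (r : Fin k → ℕ) →
    k ≥ 3 →
    (∀ i j → i ≤F j → r j ≤ r i) →
    (∀ j → r j ≥ 2) →
    (∀ j → r j ≢ 3) →
    ((m : ℕ) → m ≤ (2 * k ∸ 2) ⊓ (Σ[ (λ i → ⌈ r i /2⌉) ] ∸ 1) →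
      Game.B1PreventsFullColoring k r m)
    × (2 ∣ Σ[ r ] → (m : ℕ) → m ≤ 2 * k ∸ 2 →
      Game.B1PreventsFullColoring k r m)
lemma6 k r k≥3 _ r≥2 r≢3 = below-both-bounds , below-2k-2-if-even
  where
  m+2≤2k : ∀ {m} → m ≤ 2 * k ∸ 2 → m + 2 ≤ 2 * k
  m+2≤2k {m} = m≤o∸n⇒m+n≤o m (≤-trans (n≤1+n 2) (≤-trans k≥3 (m≤m+n k _)))
  below-both-bounds : ∀ m → m ≤ (2 * k ∸ 2) ⊓ (Σ[ (λ i → ⌈ r i /2⌉) ] ∸ 1) →
                      Game.B1PreventsFullColoring k r m
  below-both-bounds m m≤ = Strategy.prevents k r m r≥2 r≢3 (m+2≤2k (m≤n⊓o⇒m≤n _ _ m≤)) λ _ →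
    subst (_≤ Σ[ (λ i → ⌈ r i /2⌉) ]) (+-comm m 1) (m≤o∸n⇒m+n≤o m 1≤Σ (m≤n⊓o⇒m≤o _ _ m≤))
    where
    part₀ : Fin k
    part₀ = fromℕ< (≤-trans z<s k≥3)
    1≤Σ : 1 ≤ Σ[ (λ i → ⌈ r i /2⌉) ]
    1≤Σ = ≤-trans (⌈n/2⌉-mono (r≥2 part₀))
      (≤-trans (≤-sum (λ i → ⌈ r i /2⌉) part₀) (≤-reflexive (sym (Σ[]≡sum λ i → ⌈ r i /2⌉))))
  below-2k-2-if-even : 2 ∣ Σ[ r ] → ∀ m → m ≤ 2 * k ∸ 2 → Game.B1PreventsFullColoring k r m
  below-2k-2-if-even even m m≤ = Strategy.prevents k r m r≥2 r≢3 (m+2≤2k m≤) (contradiction even)
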